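{- Let $\Pi$ be a GSP of an SF instance $I=(A,\succ,c)$ containing cyclic permutations $\Pi_r,\Pi_s$. Then for all distinct $a_i,a_j\in A$, if $\Pi_r(a_j)=a_i$ and $\Pi_s(a_i)=a_j$, then $\Pi_r=\Pi_s$.
   Context: A Stable Fixtures (SF) instance is $I=(A,\succ,c)$ where $A=\{a_1,\dots,a_n\}$ is a finite set of $n$ agents; each agent $a_i$ has a strict linear order $\succ_i$ over $A\setminus\{a_i\}$ (complete preference list), with the convention that every agent ranks itself last ($a_j\succ_i a_i$ for all $j\neq i$); $a\succeq_i b$ means $a\succ_i b$ or $a=b$. Each agent has an integer capacity $c_i$ with $1\le c_i<n$. A cyclic permutation of a nonempty set $A_r\subseteq A$ is a permutation $\Pi_r$ of $A_r$ consisting of a single cycle of length $|A_r|$ (length 1: a fixed point $(a_i)$; length 2: a transposition $(a_i\ a_j)$). Two cyclic permutations are distinct if some element is mapped to different elements by them. A GSP (generalised stable partition) of $I$ is a finite collection $\Pi=\{\Pi_1,\dots,\Pi_k\}$ of cyclic permutations $\Pi_r$ of sets $A_r\subseteq A$, pairwise distinct except that fixed points may be repeated, such that: (F1) for every $r$ and every $a_j\in A_r$, $\Pi_r(a_j)\succeq_j\Pi_r^{ -1}(a_j)$; (F2) there are no distinct $a_i,a_j\in A$ with the transposition $(a_i\ a_j)\notin\Pi$ such that $a_j\succ_i\Pi_r^{ -1}(a_i)$ and $a_i\succ_j\Pi_s^{ -1}(a_j)$ for some $\Pi_r,\Pi_s\in\Pi$ with $a_i\in A_r$, $a_j\in A_s$;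 (F3) for every $a_i\in A$, the number of indices $r$ with $a_i\in A_r$ equals $c_i$; (F4) for all distinct $a_i,a_j\in A$, $|\{s:\Pi_s(a_i)=a_j\}|+|\{s:\Pi_s(a_j)=a_i\}|\le 2$. -}

module Defs where

open import Data.Nat using (ℕ; zero; suc; _+_; _<_; _≤_)
open import Data.Fin using (Fin; zero; suc)
open import Data.Fin.Properties using (_≟_)
open import Data.Bool using (Bool; true; false; _∧_)
open import Data.Product using (Σ; ∃; _×_; _,_)
open import Data.Sum using (_⊎_)
open import Relation.Binary.PropositionalEquality using (_≡_; _≢_)
open import Relation.Nullary using (¬_)
open import Relation.Nullary.Decidable using (⌊_⌋)
open import Function.Bundles using (_⇔_)

iter : ∀ {n : ℕ} → (Fin n → Fin n) → ℕ → Fin n → Fin n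
iter f zero    a = a
iter f (suc m) a = f (iter f m a)

countTrue : ∀ {k : ℕ} → (Fin k → Bool) → ℕ
countTrue {zero}  f = 0
countTrue {suc k} f with f zero
... | true  = suc (countTrue (λ r → f (suc r)))
... | false = countTrue (λ r → f (suc r))

-- An SF instance with agents a_0..a_{n-1} (= Fin n).
-- rank i : position of each agent in agent i's strict, complete preference
-- list (smaller = better); injective, so it is a strict linear order,
-- and agent i ranks itself last.
record SF (n : ℕ) : Set where
  field
    rank       : Fin n → Fin n → ℕ
    rank-inj   : ∀ i a b → rank i a ≡ rank i b → a ≡ b
    self-last  : ∀ i j → j ≢ i → rank i j < rank i i
    cap        : Fin n → ℕ
    cap-pos    : ∀ i → 1 ≤ cap i
    cap-bound  : ∀ i → cap i < n

open SF public

Prefers : ∀ {n} (I : SF n) → Fin n → Fin n → Fin n → Set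
Prefers I i a b = rank I i a < rank I i b

PrefersEq : ∀ {n} (I : SF n) → Fin n → Fin n → Fin n → Set
PrefersEq I i a b = Prefers I i a b ⊎ a ≡ b

-- A cyclic permutation Π_r of a nonempty set A_r ⊆ A:
-- dom is (the characteristic function of) A_r, σ is Π_r (only its values
-- on A_r matter); σ maps A_r injectively into A_r and A_r forms a single cycle.
record CycPerm (n : ℕ) : Set where
  field
    dom       : Fin n → Bool
    σ         : Fin n → Fin n
    nonempty  : ∃ λ a → dom a ≡ true
    closed    : ∀ a → dom a ≡ true → dom (σ a) ≡ true
    injective : ∀ a b → dom a ≡ true → dom b ≡ true → σ a ≡ σ b → a ≡ b
    one-cycle : ∀ a b → dom a ≡ true → dom b ≡ true → ∃ λ m → iter σ m a ≡ b

open CycPerm public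

SamePerm : ∀ {n} → CycPerm n → CycPerm n → Set
SamePerm P Q = (∀ a → dom P a ≡ dom Q a) × (∀ a → dom P a ≡ true → σ P a ≡ σ Q a)

IsFixedPoint : ∀ {n} → CycPerm n → Set
IsFixedPoint P = ∃ λ a → ∀ b → (dom P b ≡ true) ⇔ (b ≡ a)

IsTransposition : ∀ {n} → Fin n → Fin n → CycPerm n → Set
IsTransposition i j P =
  (∀ b → (dom P b ≡ true) ⇔ (b ≡ i ⊎ b ≡ j)) × σ P i ≡ j × σ P j ≡ i

IsPred : ∀ {n} → CycPerm n → Fin n → Fin n → Set
IsPred P a p = dom P a ≡ true × dom P p ≡ true × σ P p ≡ a

record IsGSP {n : ℕ} (I : SF n) {k : ℕ} (Π : Fin k → CycPerm n) : Set where
  field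
    distinct : ∀ r s → r ≢ s → SamePerm (Π r) (Π s) → IsFixedPoint (Π r)
    F1 : ∀ r a p → IsPred (Π r) a p → PrefersEq I a (σ (Π r) a) p
    F2 : ¬ (Σ (Fin n) λ i → Σ (Fin n) λ j → Σ (Fin k) λ r → Σ (Fin k) λ s →
            Σ (Fin n) λ p → Σ (Fin n) λ q →
              i ≢ j
            × ¬ (∃ λ t → IsTransposition i j (Π t))
            × IsPred (Π r) i p × Prefers I i j p
            × IsPred (Π s) j q × Prefers I j i q)
    F3 : ∀ i → countTrue (λ r → dom (Π r) i) ≡ cap I i
    F4 : ∀ i j → i ≢ j →
           countTrue (λ t → dom (Π t) i ∧ ⌊ σ (Π t) i ≟ j ⌋)
         + countTrue (λ t → dom (Π t) j ∧ ⌊ σ (Π t) j ≟ i ⌋) ≤ 2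

-- If Π_r ≠ Π_s, the arcs j → i of Π_r and i → j of Π_s are counted by F4. If Π_r
-- also maps i to j, or Π_s maps j to i, a third arc between i and j appears and
-- F4 fails. Otherwise both arcs are one-way: by F1 agent i strictly prefers j to
-- its predecessor in Π_s and agent j prefers i to its predecessor in Π_r, so by
-- F2 the transposition (i j) belongs to Π, again giving three arcs. Hence Π_r
-- maps i to j and Π_s maps j to i, i.e. both are the transposition (i j).
module Submission where

open import Defs
open import Data.Nat using (ℕ; zero; suc; _≤_; z≤n; s≤s)
open import Data.Nat.Properties using (+-mono-≤; ≤-trans; 1+n≰n)
open import Data.Fin using (Fin; zero; suc)
open import Data.Fin.Properties using (_≟_)
open import Data.Bool using (Bool; true; false; _∧_)
open import Data.Bool.Properties using (T-≡)
open import Data.Product using (∃; _×_; _,_)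
open import Data.Sum using (_⊎_; inj₁; inj₂)
open import Data.Empty using (⊥; ⊥-elim)
open import Relation.Nullary using (¬_; yes; no)
open import Relation.Nullary.Decidable using (⌊_⌋; fromWitness)
open import Relation.Binary.PropositionalEquality
  using (_≡_; _≢_; refl; sym; trans; cong)
open import Function.Bundles using (Equivalence)

1≤countTrue : ∀ {k} (f : Fin k → Bool) {a} → f a ≡ true → 1 ≤ countTrue f
1≤countTrue {suc k} f {zero} fa rewrite fa = s≤s z≤n
1≤countTrue {suc k} f {suc a} fa with f zero
... | true  = s≤s z≤n
... | false = 1≤countTrue (λ r → f (suc r)) fa

2≤countTrue : ∀ {k} (f : Fin k → Bool) {a b} → a ≢ b →
              f a ≡ true → f b ≡ true → 2 ≤ countTrue f
2≤countTrue {suc k} f {zero}  {zero}  a≢b fa fb = ⊥-elim (a≢b refl)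
2≤countTrue {suc k} f {zero}  {suc b} a≢b fa fb rewrite fa =
  s≤s (1≤countTrue (λ r → f (suc r)) fb)
2≤countTrue {suc k} f {suc a} {zero}  a≢b fa fb rewrite fb =
  s≤s (1≤countTrue (λ r → f (suc r)) fa)
2≤countTrue {suc k} f {suc a} {suc b} a≢b fa fb with f zero
... | true  = s≤s (1≤countTrue (λ r → f (suc r)) fa)
... | false = 2≤countTrue (λ r → f (suc r)) (λ a≡b → a≢b (cong suc a≡b)) fa fb

PrefersEq⇒Prefers : ∀ {n} (I : SF n) {i a b} → PrefersEq I i a b → a ≢ b → Prefers I i a b
PrefersEq⇒Prefers I (inj₁ a≻b) a≢b = a≻b
PrefersEq⇒Prefers I (inj₂ a≡b) a≢b = ⊥-elim (a≢b a≡b)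

module _ {n : ℕ} where

  record HasArc (P : CycPerm n) (a b : Fin n) : Set where
    constructor arc
    field
      source-∈ : dom P a ≡ true
      maps-to  : σ P a ≡ b

  open HasArc public

  isArc : CycPerm n → Fin n → Fin n → Bool
  isArc P a b = dom P a ∧ ⌊ σ P a ≟ b ⌋

  isArc-true : ∀ {P a b} → HasArc P a b → isArc P a b ≡ true
  isArc-true {P} {a} {b} (arc a∈P refl) rewrite a∈P = Equivalence.to T-≡ (fromWitness refl)

  arc-target-∈ : ∀ {P a b} → HasArc P a b → dom P b ≡ true
  arc-target-∈ {P} (arc a∈P refl) = closed P _ a∈P

  iter-∈ : ∀ (P : CycPerm n) m {a} → dom P a ≡ true → dom P (iter (σ P) m a) ≡ true
  iter-∈ P zero    a∈P = a∈P
  iter-∈ P (suc m) a∈P = closed P _ (iter-∈ P m a∈P)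

  predecessor : ∀ (P : CycPerm n) {a} → dom P a ≡ true → ∃ (IsPred P a)
  predecessor P {a} a∈P with one-cycle P (σ P a) a (closed P a a∈P) a∈P
  ... | zero  , σa≡a = a , a∈P , a∈P , σa≡a
  ... | suc m , e    = iter (σ P) m (σ P a) , a∈P , iter-∈ P m (closed P a a∈P) , e

  iter-swap : ∀ (f : Fin n → Fin n) {i j} → f i ≡ j → f j ≡ i →
              ∀ m → iter f m i ≡ i ⊎ iter f m i ≡ j
  iter-swap f fi≡j fj≡i zero = inj₁ refl
  iter-swap f fi≡j fj≡i (suc m) with iter-swap f fi≡j fj≡i m
  ... | inj₁ e rewrite e = inj₂ fi≡j
  ... | inj₂ e rewrite e = inj₁ fj≡i

  swap-dom : ∀ (P : CycPerm n) {i j} → HasArc P i j → HasArc P j i →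
             ∀ a → dom P a ≡ true → a ≡ i ⊎ a ≡ j
  swap-dom P (arc i∈P σi≡j) (arc _ σj≡i) a a∈P with one-cycle P _ a i∈P a∈P
  ... | m , e with iter-swap (σ P) σi≡j σj≡i m
  ... | inj₁ x = inj₁ (trans (sym e) x)
  ... | inj₂ x = inj₂ (trans (sym e) x)

  swap-unique : ∀ (P Q : CycPerm n) {i j} → HasArc P i j → HasArc P j i →
                HasArc Q i j → HasArc Q j i → SamePerm P Q
  swap-unique P Q Pij Pji Qij Qji = same-dom , same-σ
    where
    P⊆Q : ∀ a → dom P a ≡ true → dom Q a ≡ true
    P⊆Q a a∈P with swap-dom P Pij Pji a a∈P
    ... | inj₁ refl = source-∈ Qij
    ... | inj₂ refl = source-∈ Qji
    Q⊆P : ∀ a → dom Q a ≡ true → dom P a ≡ true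
    Q⊆P a a∈Q with swap-dom Q Qij Qji a a∈Q
    ... | inj₁ refl = source-∈ Pij
    ... | inj₂ refl = source-∈ Pji
    same-dom : ∀ a → dom P a ≡ dom Q a
    same-dom a with dom P a in eP | dom Q a in eQ
    ... | true  | true  = refl
    ... | false | false = refl
    ... | true  | false = trans (sym (P⊆Q a eP)) eQ
    ... | false | true  = trans (sym eP) (Q⊆P a eQ)
    same-σ : ∀ a → dom P a ≡ true → σ P a ≡ σ Q a
    same-σ a a∈P with swap-dom P Pij Pji a a∈P
    ... | inj₁ refl = trans (maps-to Pij) (sym (maps-to Qij))
    ... | inj₂ refl = trans (maps-to Pji) (sym (maps-to Qji))

module _ {n : ℕ} {I : SF n} {k : ℕ} {Π : Fin k → CycPerm n} (G : IsGSP I Π) where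
  open IsGSP G

  no-three-arcs : ∀ {i j r s t} → i ≢ j → r ≢ s →
                  HasArc (Π r) i j → HasArc (Π s) i j → HasArc (Π t) j i → ⊥
  no-three-arcs {i} {j} i≢j r≢s rij sij tji = 1+n≰n (≤-trans three≤arcs (F4 i j i≢j))
    where
    three≤arcs = +-mono-≤
      (2≤countTrue (λ u → isArc (Π u) i j) r≢s (isArc-true rij) (isArc-true sij))
      (1≤countTrue (λ u → isArc (Π u) j i) (isArc-true tji))

  one-way-arc-improves : ∀ {r a b} → HasArc (Π r) a b → σ (Π r) b ≢ a →
                         ∃ λ p → IsPred (Π r) a p × Prefers I a b p
  one-way-arc-improves {r} {a} (arc a∈r refl) σb≢a with predecessor (Π r) a∈r
  ... | p , pred@(_ , _ , σp≡a) =
    p , pred , PrefersEq⇒Prefers I (F1 r a p pred) (λ { refl → σb≢a σp≡a })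

  no-opposite-one-way-arcs : ∀ {r s i j} → i ≢ j →
    HasArc (Π s) i j → σ (Π s) j ≢ i → HasArc (Π r) j i → σ (Π r) i ≢ j → ⊥
  no-opposite-one-way-arcs {r} {s} {i} {j} i≢j sij σsj≢i rji σri≢j
    with one-way-arc-improves sij σsj≢i | one-way-arc-improves rji σri≢j
  ... | p , pred-p , j≻p | q , pred-q , i≻q =
    F2 (i , j , s , r , p , q , i≢j , no-swap , pred-p , j≻p , pred-q , i≻q)
    where
    no-swap : ¬ (∃ λ t → IsTransposition i j (Π t))
    no-swap (t , t-dom , σti≡j , σtj≡i) =
      no-three-arcs i≢j t≢s (arc ti σti≡j) sij (arc tj σtj≡i)
      where
      ti = Equivalence.from (t-dom i) (inj₁ refl)
      tj = Equivalence.from (t-dom j) (inj₂ refl)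
      t≢s : t ≢ s
      t≢s refl = σsj≢i σtj≡i

  opposite-arcs-same-perm : ∀ {r s i j} → i ≢ j →
    HasArc (Π r) j i → HasArc (Π s) i j → SamePerm (Π r) (Π s)
  opposite-arcs-same-perm {r} {s} {i} {j} i≢j rji sij
    with r ≟ s | σ (Π r) i ≟ j | σ (Π s) j ≟ i
  ... | yes refl | _ | _ = (λ _ → refl) , (λ _ _ → refl)
  ... | no r≢s | yes σri≡j | yes σsj≡i =
    swap-unique (Π r) (Π s) (arc (arc-target-∈ rji) σri≡j) rji sij (arc (arc-target-∈ sij) σsj≡i)
  ... | no r≢s | yes σri≡j | no _ =
    ⊥-elim (no-three-arcs i≢j r≢s (arc (arc-target-∈ rji) σri≡j) sij rji)
  ... | no r≢s | no _ | yes σsj≡i =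
    ⊥-elim (no-three-arcs (λ j≡i → i≢j (sym j≡i)) r≢s rji (arc (arc-target-∈ sij) σsj≡i) sij)
  ... | no _ | no σri≢j | no σsj≢i =
    ⊥-elim (no-opposite-one-way-arcs i≢j sij σsj≢i rji σri≢j)

lemma2 : ∀ {n : ℕ} (I : SF n) {k : ℕ} (Π : Fin k → CycPerm n) → IsGSP I Π →
    ∀ (r s : Fin k) (i j : Fin n) → i ≢ j →
    dom (Π r) j ≡ true → σ (Π r) j ≡ i →
    dom (Π s) i ≡ true → σ (Π s) i ≡ j →
    SamePerm (Π r) (Π s)
lemma2 I Π G r s i j i≢j j∈r σrj≡i i∈s σsi≡j =
  opposite-arcs-same-perm G i≢j (arc j∈r σrj≡i) (arc i∈s σsi≡j)
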